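{- Let $\mathsf{G}$ be a global type and $A$ a participant such that $\mathsf{G}{\upharpoonright}_A$ is defined. Then for every $w\in\widehat{\mathcal{L}}(\mathsf{G})$, $w{\upharpoonright}_A\in\widehat{\mathbb{L}}(A\triangleright\mathsf{G}{\upharpoonright}_A)$.
   Context: Fix participants $\mathfrak{P}$ and messages $\mathfrak{M}$; interactions $A\to B{:}m$; actions $AB!m$ ($A$ sends $m$ to $B$) and $AB?m$ ($B$ receives $m$ from $A$). Global types: coinductively $\mathsf{G}::=\mathtt{end}\mid A\to B:\{m_i.\mathsf{G}_i\}_{1\le i\le n}$ with pairwise distinct $m_i$ and regular trees. Processes: coinductively $P::=\mathbf{0}\mid C?\{m_i.P_i\}_i\mid C!\{m_i.P_i\}_i$. $\Lambda\uplus\Lambda'=\Lambda\cup\Lambda'$ if the message sets are disjoint, else undefined. Projection $\mathsf{G}{\upharpoonright}_X$ (partial, coinductive, for $X$ with bounded occurrence depths in $\mathsf{G}$): $\mathtt{end}{\upharpoonright}_X=\mathbf{0}$; for $\mathsf{G}=A\to B:\{m_i.\mathsf{G}_i\}_{1\le i\le n}$: $\mathbf{0}$ if $X$ not in $\mathsf{G}$; $B!\{m_i.\mathsf{G}_i{\upharpoonright}_X\}_i$ if $X=A$; $A?\{m_i.\mathsf{G}_i{\upharpoonright}_X\}_i$ if $X=B$; $\mathsf{G}_1{\upharpoonright}_X$ if $X\notin\{A,B\}$, $n=1$; $S?(\Lambda_1\uplus\cdots\uplus\Lambda_n)$ if $X\notin\{A,B\}$, $n>1$, $\mathsf{G}_i{\upharpoonright}_X=S?\Lambda_i$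 for all $i$; undefined otherwise. Languages (coinductive, containing finite and infinite words): $\widehat{\mathcal{L}}(\mathtt{end})=\{\varepsilon\}$, $\widehat{\mathcal{L}}(A\to B:\{m_i.\mathsf{G}_i\}_i)=\bigcup_i\{(A\to B{:}m_i)\cdot w\mid w\in\widehat{\mathcal{L}}(\mathsf{G}_i)\}$; for a named process, $\widehat{\mathbb{L}}(B\triangleright\mathbf{0})=\{\varepsilon\}$, $\widehat{\mathbb{L}}(B\triangleright C!\{m_i.P_i\}_i)=\bigcup_i\{BC!m_i\cdot v\mid v\in\widehat{\mathbb{L}}(B\triangleright P_i)\}$, $\widehat{\mathbb{L}}(B\triangleright C?\{m_i.P_i\}_i)=\bigcup_i\{CB?m_i\cdot v\mid v\in\widehat{\mathbb{L}}(B\triangleright P_i)\}$. Word projection: $(A\to B{:}m){\upharpoonright}_A=AB!m$, $(A\to B{:}m){\upharpoonright}_B=AB?m$, $\varepsilon$ for other participants, extended homomorphically. -}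

module Defs where

open import Data.Nat using (ℕ; zero; suc; _≤_)
open import Data.Fin using (Fin; zero; suc; _≟_)
open import Data.List using (List; []; _∷_)
open import Data.Maybe using (Maybe; just; nothing)
import Data.Maybe as Maybe
open import Data.Product using (Σ; _×_; _,_)
open import Data.Sum using (_⊎_; inj₁; inj₂)
open import Data.Unit using (⊤; tt)
open import Data.Empty using (⊥)
open import Relation.Nullary using (¬_; yes; no)
open import Relation.Binary.PropositionalEquality using (_≡_; _≢_)

prefix : {Σ : Set} → ℕ → (ℕ → Σ) → List Σ
prefix zero    w = []
prefix (suc n) w = w zero ∷ prefix n (λ k → w (suc k))

data Word (Σ : Set) : Set where
  fin : List Σ → Word Σ
  inf : (ℕ → Σ) → Word Σ

module Session (𝔓 𝔐 : Set) where

  data Interaction : Set where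
    ia : (A B : 𝔓) (m : 𝔐) → Interaction

  data Action : Set where
    snd : (A B : 𝔓) (m : 𝔐) → Action              -- AB!m  (A sends m to B)
    rcv : (A B : 𝔓) (m : 𝔐) → Action              -- AB?m  (B receives m from A)

  data GNode (S : Set) : Set where
    end : GNode S
    com : (A B : 𝔓) (k : ℕ) (msg : Fin (suc k) → 𝔐) →
          (∀ i j → msg i ≡ msg j → i ≡ j) → (cont : Fin (suc k) → S) → GNode S

  record Global : Set where
    field
      N    : ℕ
      δ    : Fin N → GNode (Fin N)
      root : Fin N

  open Global public

  data GStep {S : Set} : GNode S → Interaction → S → Set where
    gstep : ∀ {A B k msg inj cont} (i : Fin (suc k)) →
            GStep (com A B k msg inj cont) (ia A B (msg i)) (cont i)

  data Succ {S : Set} : GNode S → S → Set where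
    succ : ∀ {A B k msg inj cont} (i : Fin (suc k)) → Succ (com A B k msg inj cont) (cont i)

  data Reach (G : Global) : Fin (N G) → Fin (N G) → Set where
    here  : ∀ {s} → Reach G s s
    there : ∀ {s s' t} → Succ (δ G s) s' → Reach G s' t → Reach G s t

  data OccN {S : Set} (P : S → Set) (X : 𝔓) : GNode S → Set where
    inA : ∀ {A B k msg inj cont} → X ≡ A → OccN P X (com A B k msg inj cont)
    inB : ∀ {A B k msg inj cont} → X ≡ B → OccN P X (com A B k msg inj cont)
    inC : ∀ {A B k msg inj cont} (i : Fin (suc k)) → P (cont i) → OccN P X (com A B k msg inj cont)

  data Occ (G : Global) (X : 𝔓) (s : Fin (N G)) : Set where
    occ : OccN (Occ G X) X (δ G s) → Occ G X s

  -- bounded occurrence depth: in every subtree in which X occurs, every path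
  -- reaches an interaction of X (or leaves the part where X occurs) within d steps

  data AtTop {S : Set} (X : 𝔓) : GNode S → Set where
    atA : ∀ {A B k msg inj cont} → X ≡ A → AtTop X (com A B k msg inj cont)
    atB : ∀ {A B k msg inj cont} → X ≡ B → AtTop X (com A B k msg inj cont)

  data AllCont {S : Set} (P : S → Set) : GNode S → Set where
    allCont : ∀ {A B k msg inj cont} → (∀ i → P (cont i)) → AllCont P (com A B k msg inj cont)

  data Within (G : Global) (X : 𝔓) : ℕ → Fin (N G) → Set where
    absent : ∀ {d s} → ¬ Occ G X s → Within G X d s
    top    : ∀ {d s} → AtTop X (δ G s) → Within G X d s
    step   : ∀ {d s} → AllCont (Within G X d) (δ G s) → Within G X (suc d) s

  BoundedDepth : Global → 𝔓 → Set
  BoundedDepth G X = ∀ s → Reach G (root G) s → Σ ℕ λ d → Within G X d s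

  data PNode (S : Set) : Set where
    𝟎   : PNode S
    _!_ : 𝔓 → (𝔐 → Maybe S) → PNode S
    _¿_ : 𝔓 → (𝔐 → Maybe S) → PNode S

  mapPNode : {S T : Set} → (S → T) → PNode S → PNode T
  mapPNode f 𝟎       = 𝟎
  mapPNode f (C ! Λ) = C ! (λ m → Maybe.map f (Λ m))
  mapPNode f (C ¿ Λ) = C ¿ (λ m → Maybe.map f (Λ m))

  record Proc : Set₁ where
    field
      St    : Set
      pδ    : St → PNode St
      proot : St

  open Proc public

  atP : (P : Proc) → St P → Proc
  atP P s = record { St = St P ; pδ = pδ P ; proot = s }

  -- the process  S?Λ_i  where Λ_i is the restriction of Λ to the messages m with part m = i
  restrictP : (P : Proc) {k : ℕ} (S : 𝔓) (Λ : 𝔐 → Maybe (St P)) (part : 𝔐 → Fin k) (i : Fin k) → Proc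
  restrictP P S Λ part i = record
    { St    = ⊤ ⊎ St P
    ; pδ    = δ'
    ; proot = inj₁ tt }
    where
    δ' : ⊤ ⊎ St P → PNode (⊤ ⊎ St P)
    δ' (inj₁ _) = S ¿ (λ m → restr (part m ≟ i) (Λ m))
      where
      restr : {Q : Set} → Relation.Nullary.Dec Q → Maybe (St P) → Maybe (⊤ ⊎ St P)
      restr (yes _) x = Maybe.map inj₂ x
      restr (no _)  x = nothing
    δ' (inj₂ s) = mapPNode inj₂ (pδ P s)

  data PStep (B : 𝔓) {S : Set} : PNode S → Action → S → Set where
    psnd : ∀ {C Λ m s'} → Λ m ≡ just s' → PStep B (C ! Λ) (snd B C m) s'
    prcv : ∀ {C Λ m s'} → Λ m ≡ just s' → PStep B (C ¿ Λ) (rcv C B m) s'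

  data IsEnd {S : Set} : GNode S → Set where
    isEnd : IsEnd end

  data IsZero {S : Set} : PNode S → Set where
    isZero : IsZero 𝟎

  data GTrace (G : Global) : Fin (N G) → List Interaction → Set where
    gnil  : ∀ {s} → IsEnd (δ G s) → GTrace G s []
    gcons : ∀ {s a s' l} → GStep (δ G s) a s' → GTrace G s' l → GTrace G s (a ∷ l)

  _∈ℒ_ : Word Interaction → Global → Set
  fin l ∈ℒ G = GTrace G (root G) l
  inf w ∈ℒ G = Σ (ℕ → Fin (N G)) λ r → r zero ≡ root G × (∀ n → GStep (δ G (r n)) (w n) (r (suc n)))

  data PTrace (B : 𝔓) (P : Proc) : St P → List Action → Set where
    pnil  : ∀ {s} → IsZero (pδ P s) → PTrace B P s []
    pcons : ∀ {s a s' l} → PStep B (pδ P s) a s' → PTrace B P s' l → PTrace B P s (a ∷ l)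

  _∈𝕃_▷_ : Word Action → 𝔓 → Proc → Set
  fin l ∈𝕃 B ▷ P = PTrace B P (proot P) l
  inf v ∈𝕃 B ▷ P = Σ (ℕ → St P) λ r → r zero ≡ proot P × (∀ n → PStep B (pδ P (r n)) (v n) (r (suc n)))

  data ProjAct (X : 𝔓) : Interaction → Action → Set where
    pjA : ∀ {A B m} → X ≡ A → ProjAct X (ia A B m) (snd A B m)
    pjB : ∀ {A B m} → X ≢ A → X ≡ B → ProjAct X (ia A B m) (rcv A B m)

  data NotInv (X : 𝔓) : Interaction → Set where
    notInv : ∀ {A B m} → X ≢ A → X ≢ B → NotInv X (ia A B m)

  data ProjList (X : 𝔓) : List Interaction → List Action → Set where
    []   : ProjList X [] []
    keep : ∀ {a b l l'} → ProjAct X a b → ProjList X l l' → ProjList X (a ∷ l) (b ∷ l')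
    drop : ∀ {a l l'} → NotInv X a → ProjList X l l' → ProjList X (a ∷ l) l'

  ProjW : 𝔓 → Word Interaction → Word Action → Set
  ProjW X (fin l) (fin l') = ProjList X l l'
  ProjW X (fin l) (inf v)  = ⊥
  ProjW X (inf w) (fin l') =
    Σ ℕ λ n → ProjList X (prefix n w) l' × (∀ m → n ≤ m → NotInv X (w m))
  ProjW X (inf w) (inf v)  =
    Σ (ℕ → ℕ) λ idx →
        (∀ k → Data.Nat._<_ (idx k) (idx (suc k)))
      × (∀ k → ProjAct X (w (idx k)) (v k))
      × (∀ j → ¬ NotInv X (w j) → Σ ℕ λ k → idx k ≡ j)

  module _ (G : Global) (R : Fin (N G) → Proc → Set) (X : 𝔓) (P : Proc) where

    data Branch {k : ℕ} (msg : Fin (suc k) → 𝔐) (cont : Fin (suc k) → Fin (N G)) (m : 𝔐) :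
                Maybe (St P) → Set where
      absent  : (∀ i → msg i ≢ m) → Branch msg cont m nothing
      present : ∀ {s'} (i : Fin (suc k)) → msg i ≡ m → R (cont i) (atP P s') → Branch msg cont m (just s')

    -- one unfolding of the defining clauses of projection; occ = "X occurs in G"
    data Clause (occ : Set) : GNode (Fin (N G)) → PNode (St P) → Set where
      cEnd   : Clause occ end 𝟎
      cNot   : ∀ {g} → ¬ occ → Clause occ g 𝟎
      cSend  : ∀ {A B k msg inj cont Λ} → occ → X ≡ A →
               (∀ m → Branch msg cont m (Λ m)) → Clause occ (com A B k msg inj cont) (B ! Λ)
      cRecv  : ∀ {A B k msg inj cont Λ} → occ → X ≢ A → X ≡ B →
               (∀ m → Branch msg cont m (Λ m)) → Clause occ (com A B k msg inj cont) (A ¿ Λ)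
      cOne   : ∀ {A B msg inj cont p} → occ → X ≢ A → X ≢ B →
               R (cont zero) P → Clause occ (com A B zero msg inj cont) p
      cMerge : ∀ {A B k msg inj cont S Λ} → occ → X ≢ A → X ≢ B →
               (part : 𝔐 → Fin (suc (suc k))) →
               (∀ i → R (cont i) (restrictP P S Λ part i)) →
               Clause occ (com A B (suc k) msg inj cont) (S ¿ Λ)

  Proj : (G : Global) → 𝔓 → Proc → Set₁
  Proj G X P =
    Σ (Fin (N G) → Proc → Set) λ R →
        R (root G) P
      × (∀ s Q → R s Q → Clause G R X Q (Occ G X s) (δ G s) (pδ Q (proot Q)))

{-# OPTIONS --safe #-}
-- Walk along a path of G and along the projection relation R at the same
-- time: each step of the path either is an action of A, which the related
-- process can perform by the send/receive clause, or is invisible to A, in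
-- which case R relates the successor to the same process (single branch) or
-- to a restriction of it (merge), whose transitions are transitions of the
-- original process.  This proves that finite projections of G-paths are
-- paths of G↾A.  A finite word of G ends in end, where G↾A is 𝟎; an infinite
-- word with finite projection eventually leaves every part of G mentioning
-- A, by bounded depth, and there G↾A is 𝟎 again; an infinite projection is
-- traced by G↾A because all its prefixes are, and processes are
-- deterministic.
module Submission where

open import Defs
open import Data.Nat using (ℕ; zero; suc; _≤_; _<_; _≤′_; ≤′-refl; ≤′-step; z≤n; _≤?_)
open import Data.Nat.Properties using (≤-refl; ≤-trans; <⇒≤; <⇒≱; ≰⇒>; ≤⇒≤′; ≤′⇒≤; m<n⇒m<1+n)
open import Data.Fin using (Fin; zero; _≟_)
open import Data.List using (List; []; _∷_; _++_; _∷ʳ_)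
open import Data.Maybe using (just)
open import Data.Maybe.Properties using (just-injective)
open import Data.Product using (Σ; _×_; _,_; proj₁; proj₂)
open import Data.Sum using (_⊎_; inj₁; inj₂)
open import Data.Unit using (⊤)
open import Data.Empty using (⊥-elim)
open import Relation.Nullary using (¬_; yes; no)
open import Relation.Binary.PropositionalEquality using (_≡_; _≢_; refl; sym; trans; cong; subst; subst₂)

prefix-suc : {Σ : Set} (n : ℕ) (w : ℕ → Σ) → prefix (suc n) w ≡ prefix n w ∷ʳ w n
prefix-suc zero    w = refl
prefix-suc (suc n) w = cong (w zero ∷_) (prefix-suc n (λ k → w (suc k)))

increasing⇒monotone : {f : ℕ → ℕ} → (∀ k → f k < f (suc k)) → ∀ {a b} → a ≤ b → f a ≤ f b
increasing⇒monotone {f} increasing a≤b = go (≤⇒≤′ a≤b)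
  where
  go : ∀ {a b} → a ≤′ b → f a ≤ f b
  go ≤′-refl            = ≤-refl
  go (≤′-step {b} a≤′b) = ≤-trans (go a≤′b) (<⇒≤ (increasing b))

module _ {𝔓 𝔐 : Set} where
  open Session 𝔓 𝔐

  data GPath (G : Global) : Fin (N G) → List Interaction → Fin (N G) → Set where
    []  : ∀ {s} → GPath G s [] s
    _∷_ : ∀ {s a s' l t} → GStep (δ G s) a s' → GPath G s' l t → GPath G s (a ∷ l) t

  data PPath (B : 𝔓) {S : Set} (next : S → PNode S) : S → List Action → S → Set where
    []  : ∀ {s} → PPath B next s [] s
    _∷_ : ∀ {s a s' l t} → PStep B (next s) a s' → PPath B next s' l t → PPath B next s (a ∷ l) t

  IsRun : (G : Global) → (ℕ → Fin (N G)) → (ℕ → Interaction) → Set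
  IsRun G r w = ∀ n → GStep (δ G (r n)) (w n) (r (suc n))

  ProjAct⇒¬NotInv : ∀ {X a b} → ProjAct X a b → ¬ NotInv X a
  ProjAct⇒¬NotInv (pjA X≡A)   (notInv X≢A _) = X≢A X≡A
  ProjAct⇒¬NotInv (pjB _ X≡B) (notInv _ X≢B) = X≢B X≡B

  NotInv-stable : ∀ {X a} → ¬ ¬ NotInv X a → NotInv X a
  NotInv-stable {a = ia A B m} ¬¬ni =
    notInv (λ X≡A → ¬¬ni (λ { (notInv X≢A _) → X≢A X≡A }))
           (λ X≡B → ¬¬ni (λ { (notInv _ X≢B) → X≢B X≡B }))

  AtTop-step⇒¬NotInv : ∀ {X S} {g : GNode S} {a s'} → AtTop X g → GStep g a s' → ¬ NotInv X a
  AtTop-step⇒¬NotInv (atA X≡A) (gstep _) (notInv X≢A _) = X≢A X≡A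
  AtTop-step⇒¬NotInv (atB X≡B) (gstep _) (notInv _ X≢B) = X≢B X≡B

  AllCont-step : ∀ {S} {P : S → Set} {g : GNode S} {a s'} → AllCont P g → GStep g a s' → P s'
  AllCont-step (allCont all) (gstep i) = all i

  ProjList-∷ʳ-keep : ∀ {X l l' a b} → ProjList X l l' → ProjAct X a b → ProjList X (l ∷ʳ a) (l' ∷ʳ b)
  ProjList-∷ʳ-keep []           p = keep p []
  ProjList-∷ʳ-keep (keep q pl) p = keep q (ProjList-∷ʳ-keep pl p)
  ProjList-∷ʳ-keep (drop q pl) p = drop q (ProjList-∷ʳ-keep pl p)

  ProjList-∷ʳ-drop : ∀ {X l l' a} → ProjList X l l' → NotInv X a → ProjList X (l ∷ʳ a) l'
  ProjList-∷ʳ-drop []           p = drop p []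
  ProjList-∷ʳ-drop (keep q pl) p = keep q (ProjList-∷ʳ-drop pl p)
  ProjList-∷ʳ-drop (drop q pl) p = drop q (ProjList-∷ʳ-drop pl p)

  ProjList-prefix-silent : ∀ {X a b l} (w : ℕ → Interaction) → a ≤ b →
                           (∀ j → a ≤ j → j < b → NotInv X (w j)) →
                           ProjList X (prefix a w) l → ProjList X (prefix b w) l
  ProjList-prefix-silent {X} {a} {l = l} w a≤b silent pl = go (≤⇒≤′ a≤b) silent
    where
    go : ∀ {b} → a ≤′ b → (∀ j → a ≤ j → j < b → NotInv X (w j)) → ProjList X (prefix b w) l
    go ≤′-refl            _      = pl
    go (≤′-step {b} a≤′b) silent =
      subst (λ u → ProjList X u l) (sym (prefix-suc b w))
        (ProjList-∷ʳ-drop (go a≤′b (λ j a≤j j<b → silent j a≤j (m<n⇒m<1+n j<b)))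
                          (silent b (≤′⇒≤ a≤′b) ≤-refl))

  ProjW-inf⇒ProjList-prefix : ∀ {X w v} → ProjW X (inf w) (inf v) →
                              Σ (ℕ → ℕ) λ idx → ∀ n → ProjList X (prefix (idx n) w) (prefix n v)
  ProjW-inf⇒ProjList-prefix {X} {w} {v} (idx , increasing , acts , covers) = idx , proj-prefix
    where
    monotone : ∀ {a b} → a ≤ b → idx a ≤ idx b
    monotone = increasing⇒monotone increasing

    uncovered : ∀ j → (∀ k → idx k ≢ j) → NotInv X (w j)
    uncovered j missed = NotInv-stable λ ¬ni → let k , idx-k≡j = covers j ¬ni in missed k idx-k≡j

    below-first : ∀ k → ¬ idx k < idx zero
    below-first k lt = <⇒≱ lt (monotone z≤n)

    between : ∀ n k → idx n < idx k → ¬ idx k < idx (suc n)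
    between n k lo hi with k ≤? n
    ... | yes k≤n = <⇒≱ lo (monotone k≤n)
    ... | no  k≰n = <⇒≱ hi (monotone (≰⇒> k≰n))

    proj-prefix : ∀ n → ProjList X (prefix (idx n) w) (prefix n v)
    proj-prefix zero =
      ProjList-prefix-silent w z≤n
        (λ j _ hi → uncovered j λ { k refl → below-first k hi }) []
    proj-prefix (suc n) =
      ProjList-prefix-silent w (increasing n)
        (λ j lo hi → uncovered j λ { k refl → between n k lo hi })
        (subst₂ (ProjList X) (sym (prefix-suc (idx n) w)) (sym (prefix-suc n v))
          (ProjList-∷ʳ-keep (proj-prefix n) (acts n)))

  PStep-deterministic : ∀ {B S} {p : PNode S} {a s₁ s₂} → PStep B p a s₁ → PStep B p a s₂ → s₁ ≡ s₂
  PStep-deterministic (psnd e₁) (psnd e₂) = just-injective (trans (sym e₁) e₂)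
  PStep-deterministic (prcv e₁) (prcv e₂) = just-injective (trans (sym e₁) e₂)

  module _ {B : 𝔓} {S : Set} {next : S → PNode S} where

    PPath-deterministic : ∀ {s l t₁ t₂} → PPath B next s l t₁ → PPath B next s l t₂ → t₁ ≡ t₂
    PPath-deterministic []          []          = refl
    PPath-deterministic (st₁ ∷ p₁) (st₂ ∷ p₂) with PStep-deterministic st₁ st₂
    ... | refl = PPath-deterministic p₁ p₂

    PPath-++⁻ : ∀ {s t} l₁ {l₂} → PPath B next s (l₁ ++ l₂) t →
                Σ S λ u → PPath B next s l₁ u × PPath B next u l₂ t
    PPath-++⁻ []       path       = _ , [] , path
    PPath-++⁻ (a ∷ l₁) (st ∷ path) = let u , p₁ , p₂ = PPath-++⁻ l₁ path in u , st ∷ p₁ , p₂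

    prefix-paths⇒run : ∀ {s} (v : ℕ → Action) → (∀ n → Σ S λ u → PPath B next s (prefix n v) u) →
                       Σ (ℕ → S) λ ρ → ρ zero ≡ s × (∀ n → PStep B (next (ρ n)) (v n) (ρ (suc n)))
    prefix-paths⇒run {s} v paths = state , sym (PPath-deterministic [] (path zero)) , advance
      where
      state : ℕ → S
      state n = proj₁ (paths n)

      path : ∀ n → PPath B next s (prefix n v) (state n)
      path n = proj₂ (paths n)

      advance : ∀ n → PStep B (next (state n)) (v n) (state (suc n))
      advance n with PPath-++⁻ (prefix n v) (subst (λ l → PPath B next s l (state (suc n)))
                                                (prefix-suc n v) (path (suc n)))
      ... | u , to-u , (st ∷ []) with PPath-deterministic to-u (path n)
      ... | refl = st

  PPath⇒PTrace : ∀ {B P s l t} → PPath B (pδ P) s l t → IsZero (pδ P t) → PTrace B P s l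
  PPath⇒PTrace []          z = pnil z
  PPath⇒PTrace (st ∷ path) z = pcons st (PPath⇒PTrace path z)

  PPath-map : ∀ {B S T} {next : S → PNode S} {next' : T → PNode T} (f : S → T) →
              (∀ {s a s'} → PStep B (next s) a s' → PStep B (next' (f s)) a (f s')) →
              ∀ {s l t} → PPath B next s l t → PPath B next' (f s) l (f t)
  PPath-map f sim []          = []
  PPath-map f sim (st ∷ path) = sim st ∷ PPath-map f sim path

  mapPNode-step⁻ : ∀ {B S T} {f : S → T} {p : PNode S} {a t} → PStep B (mapPNode f p) a t →
                   Σ S λ s → t ≡ f s × PStep B p a s
  mapPNode-step⁻ {p = C ! Λ} (psnd {m = m} e) with Λ m in eq
  mapPNode-step⁻ {p = C ! Λ} (psnd refl) | just s = s , refl , psnd eq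
  mapPNode-step⁻ {p = C ¿ Λ} (prcv {m = m} e) with Λ m in eq
  mapPNode-step⁻ {p = C ¿ Λ} (prcv refl) | just s = s , refl , prcv eq

  mapPNode-zero⁻ : ∀ {S T} {f : S → T} {p : PNode S} → IsZero (mapPNode f p) → IsZero p
  mapPNode-zero⁻ {p = 𝟎} _ = isZero

  restrictP-origin : (P : Proc) → ⊤ ⊎ St P → St P
  restrictP-origin P (inj₁ _) = proot P
  restrictP-origin P (inj₂ s) = s

  restrictP-step : ∀ {B} P {k S Λ} {part : 𝔐 → Fin k} {i} → pδ P (proot P) ≡ S ¿ Λ →
                   ∀ {t a t'} → PStep B (pδ (restrictP P S Λ part i) t) a t' →
                   PStep B (pδ P (restrictP-origin P t)) a (restrictP-origin P t')
  restrictP-step {B} P {Λ = Λ} {part} {i} root≡ {inj₁ _} (prcv {m = m} e) with part m ≟ i | Λ m in eq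
  ... | yes _ | just _ with e
  ... | refl = subst (λ p → PStep B p _ _) (sym root≡) (prcv eq)
  restrictP-step P root≡ {inj₂ _} st with mapPNode-step⁻ st
  ... | _ , refl , st' = st'

  restrictP-zero : ∀ P {k S Λ} {part : 𝔐 → Fin k} {i} t →
                   IsZero (pδ (restrictP P S Λ part i) t) → IsZero (pδ P (restrictP-origin P t))
  restrictP-zero P (inj₂ _) z = mapPNode-zero⁻ z

  GStep⇒Succ : ∀ {S} {g : GNode S} {a s'} → GStep g a s' → Succ g s'
  GStep⇒Succ (gstep i) = succ i

  GPath⇒Reach : ∀ {G s l t} → GPath G s l t → Reach G s t
  GPath⇒Reach []          = here
  GPath⇒Reach (st ∷ path) = there (GStep⇒Succ st) (GPath⇒Reach path)

  GTrace⇒GPath : ∀ {G s l} → GTrace G s l → Σ (Fin (N G)) λ t → GPath G s l t × IsEnd (δ G t)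
  GTrace⇒GPath (gnil e)      = _ , [] , e
  GTrace⇒GPath (gcons st tr) = let t , path , e = GTrace⇒GPath tr in t , st ∷ path , e

  IsRun-GPath : ∀ {G} (r : ℕ → Fin (N G)) (w : ℕ → Interaction) → IsRun G r w →
                ∀ n → GPath G (r zero) (prefix n w) (r n)
  IsRun-GPath r w run zero    = []
  IsRun-GPath r w run (suc n) =
    run zero ∷ IsRun-GPath (λ k → r (suc k)) (λ k → w (suc k)) (λ k → run (suc k)) n

  IsRun-Within⇒¬Occ : ∀ {G X r w d} → IsRun G r w → ∀ j → Within G X d (r j) →
                      (∀ m → j ≤ m → NotInv X (w m)) → Σ ℕ λ m → j ≤ m × ¬ Occ G X (r m)
  IsRun-Within⇒¬Occ run j (absent ¬occ) silent = j , ≤-refl , ¬occ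
  IsRun-Within⇒¬Occ run j (top at)      silent = ⊥-elim (AtTop-step⇒¬NotInv at (run j) (silent j ≤-refl))
  IsRun-Within⇒¬Occ run j (step all)    silent =
    let m , j<m , ¬occ = IsRun-Within⇒¬Occ run (suc j) (AllCont-step all (run j))
                                            (λ m j<m → silent m (<⇒≤ j<m))
    in  m , <⇒≤ j<m , ¬occ

  ¬OccN-step : ∀ {G X} {g : GNode (Fin (N G))} {a s'} → ¬ OccN (Occ G X) X g → GStep g a s' →
               NotInv X a × ¬ Occ G X s'
  ¬OccN-step ¬occ (gstep i) = notInv (λ X≡A → ¬occ (inA X≡A)) (λ X≡B → ¬occ (inB X≡B)) , λ o → ¬occ (inC i o)

  ¬Occ-GPath⇒ProjList-[] : ∀ {G X s l t l'} → ¬ Occ G X s → GPath G s l t → ProjList X l l' → l' ≡ []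
  ¬Occ-GPath⇒ProjList-[] ¬occ []          []            = refl
  ¬Occ-GPath⇒ProjList-[] ¬occ (st ∷ path) pl
    with ¬OccN-step (λ o → ¬occ (occ o)) st | pl
  ... | ni , _     | keep p _   = ⊥-elim (ProjAct⇒¬NotInv p ni)
  ... | _  , ¬occ' | drop _ pl' = ¬Occ-GPath⇒ProjList-[] ¬occ' path pl'

  Clause-end⇒IsZero : ∀ {G R X Q occ} {g : GNode (Fin (N G))} {p : PNode (St Q)} →
                      Clause G R X Q occ g p → IsEnd g → IsZero p
  Clause-end⇒IsZero cEnd     _ = isZero
  Clause-end⇒IsZero (cNot _) _ = isZero

  Clause-¬occ⇒IsZero : ∀ {G R X Q occ} {g : GNode (Fin (N G))} {p : PNode (St Q)} →
                       ¬ occ → Clause G R X Q occ g p → IsZero p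
  Clause-¬occ⇒IsZero ¬occ cEnd               = isZero
  Clause-¬occ⇒IsZero ¬occ (cNot _)           = isZero
  Clause-¬occ⇒IsZero ¬occ (cSend o _ _)      = ⊥-elim (¬occ o)
  Clause-¬occ⇒IsZero ¬occ (cRecv o _ _ _)    = ⊥-elim (¬occ o)
  Clause-¬occ⇒IsZero ¬occ (cOne o _ _ _)     = ⊥-elim (¬occ o)
  Clause-¬occ⇒IsZero ¬occ (cMerge o _ _ _ _) = ⊥-elim (¬occ o)

  module _ (G : Global) (X : 𝔓) (R : Fin (N G) → Proc → Set)
           (closed : ∀ s Q → R s Q → Clause G R X Q (Occ G X s) (δ G s) (pδ Q (proot Q))) where

    ProjectsTo𝟎 : Fin (N G) → Set₁
    ProjectsTo𝟎 t = ∀ Q → R t Q → IsZero (pδ Q (proot Q))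

    -- The end condition quantifies over all projections of t because the
    -- process reached need not be related to t itself: after a merge it is a
    -- restriction's state that is, and after a cNot clause nothing is.
    Follows : Proc → List Action → Fin (N G) → Set₁
    Follows Q l' t = Σ (St Q) λ u → PPath X (pδ Q) (proot Q) l' u × (ProjectsTo𝟎 t → IsZero (pδ Q u))

    Follows-∷ : ∀ {Q b s' l' t} → PStep X (pδ Q (proot Q)) b s' → Follows (atP Q s') l' t → Follows Q (b ∷ l') t
    Follows-∷ st (u , path , ends) = u , st ∷ path , ends

    Follows-restrictP : ∀ Q {k S Λ} {part : 𝔐 → Fin k} {i l' t} → pδ Q (proot Q) ≡ S ¿ Λ →
                        Follows (restrictP Q S Λ part i) l' t → Follows Q l' t
    Follows-restrictP Q {part = part} {i} root≡ (u , path , ends) =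
      restrictP-origin Q u ,
      PPath-map (restrictP-origin Q) (λ {t} → restrictP-step Q {part = part} {i} root≡ {t}) path ,
      λ z → restrictP-zero Q {part = part} {i} u (ends z)

    Branch-msg : ∀ {Q k msg cont x} → (∀ i j → msg i ≡ msg j → i ≡ j) → (i : Fin (suc k)) →
                 Branch G R X Q msg cont (msg i) x → Σ (St Q) λ s' → x ≡ just s' × R (cont i) (atP Q s')
    Branch-msg                 inj i (absent ≢msg)       = ⊥-elim (≢msg i refl)
    Branch-msg {cont = cont} inj i (present j msg≡ r) = _ , refl , subst (λ j → R (cont j) _) (inj j i msg≡) r

    project-step : ∀ {s g a s' l l' t} (Q : Proc) {p} →
                   Clause G R X Q (Occ G X s) g p → pδ Q (proot Q) ≡ p →
                   GStep g a s' → ProjList X (a ∷ l) l' → (¬ Occ G X s → l' ≡ []) →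
                   (∀ {l''} Q' → R s' Q' → ProjList X l l'' → Follows Q' l'' t) →
                   Follows Q l' t
    project-step Q (cNot ¬occ) root≡ st pl silent follow with silent ¬occ
    ... | refl = proot Q , [] , λ _ → subst IsZero (sym root≡) isZero
    project-step Q (cSend {inj = inj} _ refl br) root≡ (gstep i) (keep (pjA _) pl) _ follow =
      let s' , Λ≡ , r = Branch-msg inj i (br _)
      in  Follows-∷ (subst (λ p → PStep X p _ s') (sym root≡) (psnd Λ≡)) (follow (atP Q s') r pl)
    project-step Q (cSend _ refl _) _ (gstep _) (keep (pjB X≢A _) _) _ _ = ⊥-elim (X≢A refl)
    project-step Q (cSend _ refl _) _ (gstep _) (drop (notInv X≢A _) _) _ _ = ⊥-elim (X≢A refl)
    project-step Q (cRecv {inj = inj} _ _ refl br) root≡ (gstep i) (keep (pjB _ _) pl) _ follow =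
      let s' , Λ≡ , r = Branch-msg inj i (br _)
      in  Follows-∷ (subst (λ p → PStep X p _ s') (sym root≡) (prcv Λ≡)) (follow (atP Q s') r pl)
    project-step Q (cRecv _ X≢A refl _) _ (gstep _) (keep (pjA X≡A) _) _ _ = ⊥-elim (X≢A X≡A)
    project-step Q (cRecv _ _ refl _) _ (gstep _) (drop (notInv _ X≢B) _) _ _ = ⊥-elim (X≢B refl)
    project-step Q (cOne _ X≢A X≢B _) _ (gstep zero) (keep p _) _ _ = ⊥-elim (ProjAct⇒¬NotInv p (notInv X≢A X≢B))
    project-step Q (cOne _ _ _ r) _ (gstep zero) (drop _ pl) _ follow = follow Q r pl
    project-step Q (cMerge _ X≢A X≢B _ _) _ (gstep _) (keep p _) _ _ = ⊥-elim (ProjAct⇒¬NotInv p (notInv X≢A X≢B))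
    project-step Q (cMerge _ _ _ _ rs) root≡ (gstep i) (drop _ pl) _ follow =
      Follows-restrictP Q root≡ (follow _ (rs i) pl)

    project : ∀ {s l t l'} (Q : Proc) → R s Q → GPath G s l t → ProjList X l l' → Follows Q l' t
    project Q r []          [] = proot Q , [] , λ z → z Q r
    project {s} Q r (st ∷ path) pl =
      project-step Q (closed s Q r) refl st pl
        (λ ¬occ → ¬Occ-GPath⇒ProjList-[] ¬occ (st ∷ path) pl)
        (λ Q' r' pl' → project Q' r' path pl')

    finite-word-sound : ∀ P → R (root G) P → ∀ {l l'} → GTrace G (root G) l → ProjList X l l' →
                        PTrace X P (proot P) l'
    finite-word-sound P r₀ trace pl =
      let t , path , t-end = GTrace⇒GPath trace
          _ , ppath , ends = project P r₀ path pl
      in  PPath⇒PTrace ppath (ends λ Q q → Clause-end⇒IsZero (closed t Q q) t-end)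

    module _ {r : ℕ → Fin (N G)} {w : ℕ → Interaction} (r₀≡ : r zero ≡ root G) (run : IsRun G r w) where

      run-GPath : ∀ n → GPath G (root G) (prefix n w) (r n)
      run-GPath n = subst (λ s → GPath G s (prefix n w) (r n)) r₀≡ (IsRun-GPath r w run n)

      eventually-silent-sound : BoundedDepth G X → ∀ P → R (root G) P → ∀ {n l'} →
                                ProjList X (prefix n w) l' → (∀ m → n ≤ m → NotInv X (w m)) →
                                PTrace X P (proot P) l'
      eventually-silent-sound bounded P r₀ {n} pl silent =
        let _ , within       = bounded (r n) (GPath⇒Reach (run-GPath n))
            m , n≤m , ¬occ   = IsRun-Within⇒¬Occ run n within silent
            pl-m             = ProjList-prefix-silent w n≤m (λ j n≤j _ → silent j n≤j) pl
            _ , ppath , ends = project P r₀ (run-GPath m) pl-m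
        in  PPath⇒PTrace ppath (ends λ Q q → Clause-¬occ⇒IsZero ¬occ (closed (r m) Q q))

      infinite-word-sound : ∀ P → R (root G) P → ∀ {v} → ProjW X (inf w) (inf v) → inf v ∈𝕃 X ▷ P
      infinite-word-sound P r₀ {v} proj =
        let idx , proj-prefix = ProjW-inf⇒ProjList-prefix proj
        in  prefix-paths⇒run v λ n →
              let u , ppath , _ = project P r₀ (run-GPath (idx n)) (proj-prefix n) in u , ppath

lemma8p4 : (𝔓 𝔐 : Set) → let open Session 𝔓 𝔐 in
    (G : Global) (A : 𝔓) → BoundedDepth G A →
    (P : Proc) → Proj G A P →
    (w : Word Interaction) → w ∈ℒ G →
    (v : Word Action) → ProjW A w v →
    v ∈𝕃 A ▷ P
lemma8p4 𝔓 𝔐 G A bounded P (R , r₀ , closed) (fin l) trace (fin l') pl =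
  finite-word-sound G A R closed P r₀ trace pl
lemma8p4 𝔓 𝔐 G A bounded P _ (fin l) _ (inf v) ()
lemma8p4 𝔓 𝔐 G A bounded P (R , r₀ , closed) (inf w) (r , r₀≡ , run) (fin l') (n , pl , silent) =
  eventually-silent-sound G A R closed r₀≡ run bounded P r₀ pl silent
lemma8p4 𝔓 𝔐 G A bounded P (R , r₀ , closed) (inf w) (r , r₀≡ , run) (inf v) proj =
  infinite-word-sound G A R closed r₀≡ run P r₀ proj
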